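{- For every integer $n\ge 0$ there is a bijection $\Lambda_{a}:\mathcal{A}^n\to V_{2,4}^n$, where $\mathcal{A}^n$ is the set of 2-color partitions of $n$ with colors $r$ and $b$ in which the color $b$ appears only on even parts, and $V_{2,4}^n$ is the set of quadruples $(\lambda^{(1)},\lambda^{(2)},\lambda^{(3)},\lambda^{(4)})$ of partitions with $\sum_{i=1}^4|\lambda^{(i)}|=n$ such that $\lambda^{(1)},\lambda^{(2)},\lambda^{(3)}$ have only even parts and $\lambda^{(4)}$ is a staircase partition.
   Context: A partition of $n$ is a weakly decreasing finite sequence of positive integers summing to $n$ (the empty partition is the partition of $0$); $|\lambda|$ is the sum of the parts. A 2-color partition with colors $r,b$ is a partition each of whose parts is assigned one of the colors $r$ or $b$, parts of equal size and color being indistinguishable (equivalently, a pair consisting of the partition formed by the $r$-parts and the partition formed by the $b$-parts). A staircase partition is a partition of the form $m+(m-1)+\cdots+2+1$ for some $m\ge 0$ (the empty partition for $m=0$). -}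

module Defs where

open import Data.Nat using (ℕ; zero; suc; _+_; _<_; _≥_)
open import Data.Nat.Divisibility using (_∣_)
open import Data.List using (List; []; _∷_)
open import Data.Nat.ListAction using (sum)
open import Data.List.Relation.Unary.All using (All)
open import Data.List.Relation.Unary.Linked using (Linked)
open import Data.Product using (_×_; ∃)
open import Relation.Binary.PropositionalEquality using (_≡_)

IsPartition : List ℕ → Set
IsPartition xs = All (λ k → 0 < k) xs × Linked _≥_ xs

-- The validity proof is irrelevant, so two partitions are equal iff
-- their lists of parts are equal.
record Partition : Set where
  constructor mkPartition
  field
    parts : List ℕ
    .isPartition : IsPartition parts

open Partition public

size : Partition → ℕ
size λ′ = sum (parts λ′)

AllEven : Partition → Set
AllEven λ′ = All (λ k → 2 ∣ k) (parts λ′)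

staircase : ℕ → List ℕ
staircase zero = []
staircase (suc m) = suc m ∷ staircase m

IsStaircase : Partition → Set
IsStaircase λ′ = ∃ λ m → parts λ′ ≡ staircase m

record A (n : ℕ) : Set where
  constructor mkA
  field
    rParts : Partition
    bParts : Partition
    .bEven : AllEven bParts
    .sizeEq : size rParts + size bParts ≡ n

record V24 (n : ℕ) : Set where
  constructor mkV
  field
    λ₁ λ₂ λ₃ λ₄ : Partition
    .even₁ : AllEven λ₁
    .even₂ : AllEven λ₂
    .even₃ : AllEven λ₃
    .stair₄ : IsStaircase λ₄
    .sizeEq : size λ₁ + size λ₂ + size λ₃ + size λ₄ ≡ n

-- A partition is encoded by its boundary word (a 1 for each part, followed by as many 0s as the
-- part exceeds the next one); adding leading 0s and trailing 1s does not change the partition.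
-- Splitting a boundary word with even numbers of 0s and of 1s into its letters at even and at odd
-- positions gives two words, hence two partitions q₀ and q₁ (the 2-quotient), together with the
-- difference of their numbers of 1s, an even integer coded by m : ℕ (the 2-core is the staircase
-- with m parts). Counting inversions of the interleaved word gives |μ| = 2|q₀| + 2|q₁| + |core|,
-- and the triple determines μ because padding both halves alike pads the interleaved word by even
-- amounts. Doubling the parts of q₀ and q₁ and keeping the b-parts yields the quadruple.
module Submission where

open import Defs
open import Data.Nat using (ℕ)
open import Function.Bundles using (_⤖_)

open import Data.Bool using (Bool; true; false)
open import Data.Empty using (⊥; ⊥-elim)
open import Data.List using (List; []; _∷_; _++_; replicate; length; map)
open import Data.List.Properties using (++-assoc; length-++; length-replicate; ≡-dec)
open import Data.List.Relation.Unary.All using (All; []; _∷_; all?)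
open import Data.List.Relation.Unary.Linked as Linked using (Linked; []; [-]; _∷_; linked?)
open import Data.Nat using (zero; suc; _+_; _*_; _∸_; _≤_; _<_; _≥_; z≤n; s≤s; ⌊_/2⌋; parity)
open import Data.Nat.Divisibility using (_∣_; _∣?_; divides)
open import Data.Nat.ListAction using (sum)
open import Data.Nat.Properties
open import Data.Nat.Tactic.RingSolver using (solve-∀)
open import Data.Parity.Base using (0ℙ; 1ℙ) renaming (_+_ to _+ℙ_)
import Data.Parity.Properties as ℙ
open import Data.Product using (_×_; _,_; proj₁; proj₂; ∃; ∃₂; uncurry)
open import Data.Product.Properties using (,-injective)
open import Data.Sum using (_⊎_; inj₁; inj₂)
open import Function using (_∘_)
open import Function.Bundles using (mk↔ₛ′)
open import Function.Properties.Inverse using (↔⇒⤖)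
open import Relation.Nullary.Decidable using (Dec; recompute; _×-dec_)
open import Relation.Binary.PropositionalEquality
open ≡-Reasoning

-- diffCode x y encodes the integer x - y: as x - y when x ≥ y, as y - x - 1 otherwise.
diffCode : ℕ → ℕ → ℕ
diffCode x       zero    = x
diffCode zero    (suc y) = y
diffCode (suc x) (suc y) = diffCode x y

diffCode-spec : ∀ x y → y + diffCode x y ≡ x ⊎ x + suc (diffCode x y) ≡ y
diffCode-spec x       zero    = inj₁ refl
diffCode-spec zero    (suc y) = inj₂ refl
diffCode-spec (suc x) (suc y) with diffCode-spec x y
... | inj₁ e = inj₁ (cong suc e)
... | inj₂ e = inj₂ (cong suc e)

diffCode-+ˡ : ∀ k x y → diffCode (k + x) (k + y) ≡ diffCode x y
diffCode-+ˡ zero    x y = refl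
diffCode-+ˡ (suc k) x y = diffCode-+ˡ k x y

diffCode-cong : ∀ {x y x′ y′} → x + y′ ≡ x′ + y → diffCode x y ≡ diffCode x′ y′
diffCode-cong {x} {y} {x′} {y′} balanced = begin
  diffCode x y                 ≡⟨ sym (diffCode-+ˡ y′ x y) ⟩
  diffCode (y′ + x) (y′ + y)   ≡⟨ cong₂ diffCode (trans (+-comm y′ x) (trans balanced (+-comm x′ y))) (+-comm y′ y) ⟩
  diffCode (y + x′) (y + y′)   ≡⟨ diffCode-+ˡ y x′ y′ ⟩
  diffCode x′ y′               ∎

parity-double : ∀ n → parity (n + n) ≡ 0ℙ
parity-double n = trans (ℙ.+-homo-+ n n) (ℙ.p+p≡0ℙ (parity n))

parity-double-+ : ∀ n m → parity (n + (n + m)) ≡ parity m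
parity-double-+ n m = begin
  parity (n + (n + m))          ≡⟨ cong parity (sym (+-assoc n n m)) ⟩
  parity (n + n + m)            ≡⟨ ℙ.+-homo-+ (n + n) m ⟩
  parity (n + n) +ℙ parity m    ≡⟨ cong (_+ℙ parity m) (parity-double n) ⟩
  parity m                      ∎

parity-offset : ∀ x c {y} → x + c ≡ y → parity (x + y) ≡ parity c
parity-offset x c refl = parity-double-+ x c

parity-offset′ : ∀ {x} y c → y + c ≡ x → parity (x + y) ≡ parity c
parity-offset′ {x} y c y+c≡x = trans (cong parity (+-comm x y)) (parity-offset y c y+c≡x)

parity-suc-even : ∀ n → parity n ≡ 0ℙ → parity (suc n) ≡ 0ℙ → ⊥
parity-suc-even zero          _ ()
parity-suc-even (suc zero)    ()
parity-suc-even (suc (suc n)) = parity-suc-even n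

diffCode-injective : ∀ {x y x′ y′} → parity (x + y) ≡ 0ℙ → parity (x′ + y′) ≡ 0ℙ →
                     diffCode x y ≡ diffCode x′ y′ → x + y′ ≡ x′ + y
diffCode-injective {x} {y} {x′} {y′} even even′ c≡c′
  with diffCode x y | diffCode x′ y′ | diffCode-spec x y | diffCode-spec x′ y′ | c≡c′
... | c | .c | inj₁ y+c≡x | inj₁ y′+c≡x′ | refl rewrite sym y+c≡x | sym y′+c≡x′ = lemma y y′ c
  where
  lemma : ∀ y y′ c → y + c + y′ ≡ y′ + c + y
  lemma = solve-∀
... | c | .c | inj₂ x+c≡y | inj₂ x′+c≡y′ | refl rewrite sym x+c≡y | sym x′+c≡y′ = lemma x x′ c
  where
  lemma : ∀ x x′ c → x + (x′ + suc c) ≡ x′ + (x + suc c)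
  lemma = solve-∀
... | c | .c | inj₁ y+c≡x | inj₂ x′+c≡y′ | refl =
  ⊥-elim (parity-suc-even c (trans (sym (parity-offset′ y c y+c≡x)) even) (trans (sym (parity-offset x′ (suc c) x′+c≡y′)) even′))
... | c | .c | inj₂ x+c≡y | inj₁ y′+c≡x′ | refl =
  ⊥-elim (parity-suc-even c (trans (sym (parity-offset′ y′ c y′+c≡x′)) even′) (trans (sym (parity-offset x (suc c) x+c≡y)) even))

codeOffsets : ℕ → ℕ × ℕ
codeOffsets m with parity m
... | 0ℙ = m , 0
... | 1ℙ = 0 , suc m

diffCode-codeOffsets : ∀ m → diffCode (proj₁ (codeOffsets m)) (proj₂ (codeOffsets m)) ≡ m
diffCode-codeOffsets m with parity m
... | 0ℙ = refl
... | 1ℙ = refl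

parity-codeOffsets : ∀ m → parity (proj₁ (codeOffsets m) + proj₂ (codeOffsets m)) ≡ 0ℙ
parity-codeOffsets m with parity m in parity-m
... | 0ℙ = trans (cong parity (+-identityʳ m)) parity-m
... | 1ℙ = ℙ.⁻¹-injective (trans (ℙ.suc-homo-⁻¹ m) parity-m)

triangle : ℕ → ℕ
triangle zero    = 0
triangle (suc n) = n + triangle n

triangle-diffCode : ∀ x y → triangle (x + y) + triangle (suc (diffCode x y)) ≡ triangle x * 2 + triangle y * 2 + x
triangle-diffCode x       zero    rewrite +-identityʳ x = lemma x (triangle x)
  where
  lemma : ∀ x t → t + (x + t) ≡ t * 2 + 0 + x
  lemma = solve-∀
triangle-diffCode zero    (suc y) = lemma (triangle (suc y))
  where
  lemma : ∀ t → t + t ≡ t * 2 + 0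
  lemma = solve-∀
triangle-diffCode (suc x) (suc y) rewrite +-suc x y = begin
  suc (x + y) + (x + y + triangle (x + y)) + triangle (suc c) ≡⟨ regroup (x + y) (triangle (x + y)) (triangle (suc c)) ⟩
  suc (x + y) + (x + y) + (triangle (x + y) + triangle (suc c)) ≡⟨ cong (suc (x + y) + (x + y) +_) (triangle-diffCode x y) ⟩
  suc (x + y) + (x + y) + (triangle x * 2 + triangle y * 2 + x) ≡⟨ lemma x y (triangle x) (triangle y) ⟩
  (x + triangle x) * 2 + (y + triangle y) * 2 + suc x ∎
  where
  c : ℕ
  c = diffCode x y
  regroup : ∀ s t u → suc s + (s + t) + u ≡ suc s + s + (t + u)
  regroup = solve-∀
  lemma : ∀ x y tx ty → suc (x + y) + (x + y) + (tx * 2 + ty * 2 + x) ≡ (x + tx) * 2 + (y + ty) * 2 + suc x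
  lemma = solve-∀

parity≡0⇒double : ∀ n → parity n ≡ 0ℙ → ∃ λ k → n ≡ k + k
parity≡0⇒double zero          _    = 0 , refl
parity≡0⇒double (suc zero)    ()
parity≡0⇒double (suc (suc n)) even with parity≡0⇒double n even
... | k , n≡k+k = suc k , cong suc (trans (cong suc n≡k+k) (sym (+-suc k k)))

difference-≡ : ∀ {a b a′ b′} k k′ → a + k ≡ a′ + k′ → b + k ≡ b′ + k′ → a + b′ ≡ a′ + b
difference-≡ {a} {b} {a′} {b′} k k′ ea eb = +-cancelʳ-≡ (k + k′) _ _ (begin
  a + b′ + (k + k′)   ≡⟨ regroup a b′ k k′ ⟩
  (a + k) + (b′ + k′) ≡⟨ cong₂ _+_ ea (sym eb) ⟩
  (a′ + k′) + (b + k) ≡⟨ regroup′ a′ b k k′ ⟩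
  a′ + b + (k + k′)   ∎)
  where
  regroup : ∀ a b′ k k′ → a + b′ + (k + k′) ≡ (a + k) + (b′ + k′)
  regroup = solve-∀
  regroup′ : ∀ a′ b k k′ → (a′ + k′) + (b + k) ≡ a′ + b + (k + k′)
  regroup′ = solve-∀

Word : Set
Word = List Bool

zeros : Word → ℕ
zeros []          = 0
zeros (false ∷ w) = suc (zeros w)
zeros (true ∷ w)  = zeros w

ones : Word → ℕ
ones []          = 0
ones (false ∷ w) = ones w
ones (true ∷ w)  = suc (ones w)

zeros+ones≡length : ∀ w → zeros w + ones w ≡ length w
zeros+ones≡length []          = refl
zeros+ones≡length (false ∷ w) = cong suc (zeros+ones≡length w)
zeros+ones≡length (true ∷ w)  = trans (+-suc (zeros w) (ones w)) (cong suc (zeros+ones≡length w))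

zeros-++ : ∀ u v → zeros (u ++ v) ≡ zeros u + zeros v
zeros-++ []          v = refl
zeros-++ (false ∷ u) v = cong suc (zeros-++ u v)
zeros-++ (true ∷ u)  v = zeros-++ u v

ones-++ : ∀ u v → ones (u ++ v) ≡ ones u + ones v
ones-++ []          v = refl
ones-++ (false ∷ u) v = ones-++ u v
ones-++ (true ∷ u)  v = cong suc (ones-++ u v)

zeros-replicate-false : ∀ n → zeros (replicate n false) ≡ n
zeros-replicate-false zero    = refl
zeros-replicate-false (suc n) = cong suc (zeros-replicate-false n)

zeros-replicate-true : ∀ n → zeros (replicate n true) ≡ 0
zeros-replicate-true zero    = refl
zeros-replicate-true (suc n) = zeros-replicate-true n

ones-replicate-false : ∀ n → ones (replicate n false) ≡ 0
ones-replicate-false zero    = refl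
ones-replicate-false (suc n) = ones-replicate-false n

ones-replicate-true : ∀ n → ones (replicate n true) ≡ n
ones-replicate-true zero    = refl
ones-replicate-true (suc n) = cong suc (ones-replicate-true n)

replicate-+ : ∀ {A : Set} m n (x : A) → replicate (m + n) x ≡ replicate m x ++ replicate n x
replicate-+ zero    n x = refl
replicate-+ (suc m) n x = cong (x ∷_) (replicate-+ m n x)

pad : ℕ → ℕ → Word → Word
pad i j w = replicate i false ++ w ++ replicate j true

zeros-++-replicate-true : ∀ w j → zeros (w ++ replicate j true) ≡ zeros w
zeros-++-replicate-true w j = trans (zeros-++ w _) (trans (cong (zeros w +_) (zeros-replicate-true j)) (+-identityʳ _))

zeros-pad : ∀ i j w → zeros (pad i j w) ≡ i + zeros w
zeros-pad i j w = trans (zeros-++ (replicate i false) _) (cong₂ _+_ (zeros-replicate-false i) (zeros-++-replicate-true w j))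

ones-pad : ∀ i j w → ones (pad i j w) ≡ ones w + j
ones-pad i j w = begin
  ones (pad i j w)                                      ≡⟨ ones-++ (replicate i false) _ ⟩
  ones (replicate i false) + ones (w ++ replicate j true) ≡⟨ cong₂ _+_ (ones-replicate-false i) (ones-++ w _) ⟩
  ones w + ones (replicate j true)                        ≡⟨ cong (ones w +_) (ones-replicate-true j) ⟩
  ones w + j                                              ∎

length-pad : ∀ i j w → length (pad i j w) ≡ i + (length w + j)
length-pad i j w = trans (length-++ (replicate i false))
  (cong₂ _+_ (length-replicate i) (trans (length-++ w) (cong (length w +_) (length-replicate j))))

length-pad-cong : ∀ i j {u v} → length u ≡ length v → length (pad i j u) ≡ length (pad i j v)
length-pad-cong i j {u} {v} e = trans (length-pad i j u) (trans (cong (λ n → i + (n + j)) e) (sym (length-pad i j v)))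

pad-pad : ∀ i j a b w → pad i j (pad a b w) ≡ pad (i + a) (b + j) w
pad-pad i j a b w = begin
  F i ++ (F a ++ w ++ T b) ++ T j   ≡⟨ cong (F i ++_) (++-assoc (F a) (w ++ T b) (T j)) ⟩
  F i ++ F a ++ (w ++ T b) ++ T j   ≡⟨ sym (++-assoc (F i) (F a) _) ⟩
  (F i ++ F a) ++ (w ++ T b) ++ T j ≡⟨ cong₂ _++_ (sym (replicate-+ i a false)) (++-assoc w (T b) (T j)) ⟩
  F (i + a) ++ w ++ T b ++ T j      ≡⟨ cong (λ t → F (i + a) ++ w ++ t) (sym (replicate-+ b j true)) ⟩
  F (i + a) ++ w ++ T (b + j)       ∎
  where
  F T : ℕ → Word
  F n = replicate n false
  T n = replicate n true

infixr 5 _∷⁺_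

_∷⁺_ : ℕ → List ℕ → List ℕ
zero  ∷⁺ μ = μ
suc k ∷⁺ μ = suc k ∷ μ

-- A word is read as the boundary of a Young diagram: each 1 contributes the number of 0s to its right
-- as a part, and zeros are dropped.
part : Word → List ℕ
part []          = []
part (false ∷ w) = part w
part (true ∷ w)  = zeros w ∷⁺ part w

largestPart : List ℕ → ℕ
largestPart []      = 0
largestPart (k ∷ _) = k

boundary : List ℕ → Word
boundary []      = []
boundary (k ∷ μ) = true ∷ replicate (k ∸ largestPart μ) false ++ boundary μ

part-replicate-false-++ : ∀ i w → part (replicate i false ++ w) ≡ part w
part-replicate-false-++ zero    w = refl
part-replicate-false-++ (suc i) w = part-replicate-false-++ i w

part-++-replicate-true : ∀ w j → part (w ++ replicate j true) ≡ part w
part-++-replicate-true []          zero    = refl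
part-++-replicate-true []          (suc j) rewrite zeros-replicate-true j = part-++-replicate-true [] j
part-++-replicate-true (false ∷ w) j = part-++-replicate-true w j
part-++-replicate-true (true ∷ w)  j = cong₂ _∷⁺_ (zeros-++-replicate-true w j) (part-++-replicate-true w j)

part-pad : ∀ i j w → part (pad i j w) ≡ part w
part-pad i j w = trans (part-replicate-false-++ i _) (part-++-replicate-true w j)

∷⁺-isPartition : ∀ {k μ} → largestPart μ ≤ k → IsPartition μ → IsPartition (k ∷⁺ μ)
∷⁺-isPartition {zero}          _ μ-part                 = μ-part
∷⁺-isPartition {suc k} {[]}    _ _                      = s≤s z≤n ∷ [] , [-]
∷⁺-isPartition {suc k} {_ ∷ _} l≤k (positive , linked) = s≤s z≤n ∷ positive , l≤k ∷ linked

largestPart-part≤zeros : ∀ w → largestPart (part w) ≤ zeros w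
largestPart-part≤zeros []          = z≤n
largestPart-part≤zeros (false ∷ w) = m≤n⇒m≤1+n (largestPart-part≤zeros w)
largestPart-part≤zeros (true ∷ w) with zeros w | largestPart-part≤zeros w
... | zero  | l≤0 = l≤0
... | suc k | _   = ≤-refl

part-isPartition : ∀ w → IsPartition (part w)
part-isPartition []          = [] , []
part-isPartition (false ∷ w) = part-isPartition w
part-isPartition (true ∷ w)  = ∷⁺-isPartition (largestPart-part≤zeros w) (part-isPartition w)

largestPart-≤ : ∀ {k μ} → Linked _≥_ (k ∷ μ) → largestPart μ ≤ k
largestPart-≤ [-]       = z≤n
largestPart-≤ (k≥l ∷ _) = k≥l

zeros-boundary : ∀ μ → Linked _≥_ μ → zeros (boundary μ) ≡ largestPart μ
zeros-boundary []      _      = refl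
zeros-boundary (k ∷ μ) linked = begin
  zeros (replicate (k ∸ largestPart μ) false ++ boundary μ)           ≡⟨ zeros-++ (replicate (k ∸ largestPart μ) false) _ ⟩
  zeros (replicate (k ∸ largestPart μ) false) + zeros (boundary μ)    ≡⟨ cong₂ _+_ (zeros-replicate-false _) (zeros-boundary μ (Linked.tail linked)) ⟩
  k ∸ largestPart μ + largestPart μ                                   ≡⟨ m∸n+n≡m (largestPart-≤ linked) ⟩
  k                                                                   ∎

ones-boundary : ∀ μ → ones (boundary μ) ≡ length μ
ones-boundary []      = refl
ones-boundary (k ∷ μ) = cong suc (trans (ones-++ (replicate (k ∸ largestPart μ) false) _)
                                        (cong₂ _+_ (ones-replicate-false (k ∸ largestPart μ)) (ones-boundary μ)))

part-boundary : ∀ μ → IsPartition μ → part (boundary μ) ≡ μ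
part-boundary []          _                       = refl
part-boundary (suc k ∷ μ) (_ ∷ positive , linked) =
  cong₂ _∷⁺_ (zeros-boundary (suc k ∷ μ) linked)
             (trans (part-replicate-false-++ (suc k ∸ largestPart μ) _) (part-boundary μ (positive , Linked.tail linked)))

zeros≡0⇒replicate-true : ∀ w → zeros w ≡ 0 → w ≡ replicate (length w) true
zeros≡0⇒replicate-true []         _ = refl
zeros≡0⇒replicate-true (true ∷ w) e = cong (true ∷_) (zeros≡0⇒replicate-true w e)

boundary-normal-form : ∀ w → ∃₂ λ x y → w ≡ pad x y (boundary (part w))
boundary-normal-form []          = 0 , 0 , refl
boundary-normal-form (false ∷ w) with boundary-normal-form w
... | x , y , w≡ = suc x , y , cong (false ∷_) w≡
boundary-normal-form (true ∷ w) with zeros w in zeros≡ | boundary-normal-form w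
... | zero  | _ = 0 , suc (length w) , (begin
  true ∷ w                                       ≡⟨ cong (true ∷_) all-true ⟩
  replicate (suc (length w)) true                ≡⟨ cong (λ μ → boundary μ ++ replicate (suc (length w)) true) (sym part≡[]) ⟩
  boundary (part w) ++ replicate (suc (length w)) true ∎)
  where
  all-true : w ≡ replicate (length w) true
  all-true = zeros≡0⇒replicate-true w zeros≡
  part≡[] : part w ≡ []
  part≡[] = trans (cong part all-true) (part-pad 0 (length w) [])
... | suc k | x , y , w≡ = 0 , y , cong (true ∷_) (begin
  w                                                   ≡⟨ w≡ ⟩
  replicate x false ++ B ++ replicate y true          ≡⟨ cong (λ n → replicate n false ++ B ++ replicate y true) x≡ ⟩
  replicate (suc k ∸ largestPart (part w)) false ++ B ++ replicate y true
    ≡⟨ sym (++-assoc (replicate (suc k ∸ largestPart (part w)) false) B _) ⟩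
  (replicate (suc k ∸ largestPart (part w)) false ++ B) ++ replicate y true ∎)
  where
  B : Word
  B = boundary (part w)
  suc-k≡ : suc k ≡ x + largestPart (part w)
  suc-k≡ = begin
    suc k              ≡⟨ sym zeros≡ ⟩
    zeros w            ≡⟨ cong zeros w≡ ⟩
    zeros (pad x y B)  ≡⟨ zeros-pad x y B ⟩
    x + zeros B        ≡⟨ cong (x +_) (zeros-boundary (part w) (proj₂ (part-isPartition w))) ⟩
    x + largestPart (part w) ∎
  x≡ : x ≡ suc k ∸ largestPart (part w)
  x≡ = trans (sym (m+n∸n≡m x (largestPart (part w)))) (cong (_∸ largestPart (part w)) (sym suc-k≡))

pad-≡ : ∀ {v v′} i j i′ j′ → part v ≡ part v′ →
        i + zeros v ≡ i′ + zeros v′ → ones v + j ≡ ones v′ + j′ → pad i j v ≡ pad i′ j′ v′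
pad-≡ {v} {v′} i j i′ j′ same-part zeros≡ ones≡ with boundary-normal-form v | boundary-normal-form v′
... | a , b , v≡ | a′ , b′ , v′≡₀ = begin
  pad i j v                ≡⟨ cong (pad i j) v≡ ⟩
  pad i j (pad a b B)      ≡⟨ pad-pad i j a b B ⟩
  pad (i + a) (b + j) B    ≡⟨ cong₂ (λ k l → pad k l B) left≡ right≡ ⟩
  pad (i′ + a′) (b′ + j′) B ≡⟨ sym (pad-pad i′ j′ a′ b′ B) ⟩
  pad i′ j′ (pad a′ b′ B)  ≡⟨ cong (pad i′ j′) (sym v′≡) ⟩
  pad i′ j′ v′             ∎
  where
  B : Word
  B = boundary (part v)
  v′≡ : v′ ≡ pad a′ b′ B
  v′≡ = subst (λ μ → v′ ≡ pad a′ b′ (boundary μ)) (sym same-part) v′≡₀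
  left≡ : i + a ≡ i′ + a′
  left≡ = +-cancelʳ-≡ (zeros B) _ _ (begin
    i + a + zeros B          ≡⟨ +-assoc i a _ ⟩
    i + (a + zeros B)        ≡⟨ cong (i +_) (sym (trans (cong zeros v≡) (zeros-pad a b B))) ⟩
    i + zeros v              ≡⟨ zeros≡ ⟩
    i′ + zeros v′            ≡⟨ cong (i′ +_) (trans (cong zeros v′≡) (zeros-pad a′ b′ B)) ⟩
    i′ + (a′ + zeros B)      ≡⟨ sym (+-assoc i′ a′ _) ⟩
    i′ + a′ + zeros B        ∎)
  right≡ : b + j ≡ b′ + j′
  right≡ = +-cancelˡ-≡ (ones B) _ _ (begin
    ones B + (b + j)         ≡⟨ sym (+-assoc (ones B) b j) ⟩
    ones B + b + j           ≡⟨ cong (_+ j) (sym (trans (cong ones v≡) (ones-pad a b B))) ⟩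
    ones v + j               ≡⟨ ones≡ ⟩
    ones v′ + j′             ≡⟨ cong (_+ j′) (trans (cong ones v′≡) (ones-pad a′ b′ B)) ⟩
    ones B + b′ + j′         ≡⟨ +-assoc (ones B) b′ j′ ⟩
    ones B + (b′ + j′)       ∎)

interleave : Word → Word → Word
interleave []      q = q
interleave (x ∷ p) q = x ∷ interleave q p

split : Word → Word × Word
split []      = [] , []
split (x ∷ w) = x ∷ proj₂ (split w) , proj₁ (split w)

interleave-split : ∀ w → uncurry interleave (split w) ≡ w
interleave-split []      = refl
interleave-split (x ∷ w) = cong (x ∷_) (interleave-split w)

split-interleave : ∀ p q → length p ≡ length q → split (interleave p q) ≡ (p , q)
split-interleave []      []      _ = refl
split-interleave (_ ∷ p) (_ ∷ q) e rewrite split-interleave p q (suc-injective e) = refl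

interleave-injective : ∀ {p q p′ q′} → length p ≡ length q → length p′ ≡ length q′ →
                       interleave p q ≡ interleave p′ q′ → p ≡ p′ × q ≡ q′
interleave-injective {p} {q} {p′} {q′} e e′ same =
  ,-injective (trans (sym (split-interleave p q e)) (trans (cong split same) (split-interleave p′ q′ e′)))

length-split : ∀ k w → length w ≡ k + k → length (proj₁ (split w)) ≡ length (proj₂ (split w))
length-split _       []          _ = refl
length-split (suc k) (_ ∷ _ ∷ w) e = cong suc (length-split k w (suc-injective (trans (suc-injective e) (+-suc k k))))
length-split zero    (_ ∷ _)     ()
length-split (suc k) (_ ∷ [])    e = ⊥-elim (0≢1+n (trans (suc-injective e) (+-suc k k)))

length-interleave : ∀ p q → length (interleave p q) ≡ length p + length q
length-interleave []      q = refl
length-interleave (_ ∷ p) q = cong suc (trans (length-interleave q p) (+-comm (length q) (length p)))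

zeros-interleave : ∀ p q → zeros (interleave p q) ≡ zeros p + zeros q
zeros-interleave []          q = refl
zeros-interleave (false ∷ p) q = cong suc (trans (zeros-interleave q p) (+-comm (zeros q) (zeros p)))
zeros-interleave (true ∷ p)  q = trans (zeros-interleave q p) (+-comm (zeros q) (zeros p))

ones-interleave : ∀ p q → ones (interleave p q) ≡ ones p + ones q
ones-interleave []          q = refl
ones-interleave (false ∷ p) q = trans (ones-interleave q p) (+-comm (ones q) (ones p))
ones-interleave (true ∷ p)  q = cong suc (trans (ones-interleave q p) (+-comm (ones q) (ones p)))

interleave-++ : ∀ p q u v → length p ≡ length q → interleave (p ++ u) (q ++ v) ≡ interleave p q ++ interleave u v
interleave-++ []      []      u v _ = refl
interleave-++ (x ∷ p) (y ∷ q) u v e = cong (λ w → x ∷ y ∷ w) (interleave-++ p q u v (suc-injective e))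

interleave-replicate : ∀ {b} n → interleave (replicate n b) (replicate n b) ≡ replicate (n + n) b
interleave-replicate             zero    = refl
interleave-replicate {b} (suc n) = cong (b ∷_) (trans (cong (b ∷_) (interleave-replicate n))
                                                      (cong (λ k → replicate k b) (sym (+-suc n n))))

interleave-pad : ∀ i j p q → length p ≡ length q → interleave (pad i j p) (pad i j q) ≡ pad (i + i) (j + j) (interleave p q)
interleave-pad i j p q e = begin
  interleave (F ++ p ++ T) (F ++ q ++ T)                 ≡⟨ interleave-++ F F _ _ refl ⟩
  interleave F F ++ interleave (p ++ T) (q ++ T)         ≡⟨ cong₂ _++_ (interleave-replicate i) (interleave-++ p q T T e) ⟩
  replicate (i + i) false ++ interleave p q ++ interleave T T ≡⟨ cong (λ w → replicate (i + i) false ++ interleave p q ++ w) (interleave-replicate j) ⟩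
  pad (i + i) (j + j) (interleave p q)                   ∎
  where
  F T : Word
  F = replicate i false
  T = replicate j true

inversions : Word → ℕ
inversions []          = 0
inversions (false ∷ w) = inversions w
inversions (true ∷ w)  = zeros w + inversions w

sum-∷⁺ : ∀ k μ → sum (k ∷⁺ μ) ≡ k + sum μ
sum-∷⁺ zero    μ = refl
sum-∷⁺ (suc k) μ = refl

sum-part : ∀ w → sum (part w) ≡ inversions w
sum-part []          = refl
sum-part (false ∷ w) = sum-part w
sum-part (true ∷ w)  = trans (sum-∷⁺ (zeros w) (part w)) (cong (zeros w +_) (sum-part w))

positionSum : Word → ℕ
positionSum []          = 0
positionSum (false ∷ w) = positionSum w
positionSum (true ∷ w)  = length w + positionSum w

inversions+triangle : ∀ w → inversions w + triangle (ones w) ≡ positionSum w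
inversions+triangle []          = refl
inversions+triangle (false ∷ w) = inversions+triangle w
inversions+triangle (true ∷ w)  = begin
  zeros w + inversions w + (ones w + triangle (ones w)) ≡⟨ lemma (zeros w) (inversions w) (ones w) (triangle (ones w)) ⟩
  (zeros w + ones w) + (inversions w + triangle (ones w)) ≡⟨ cong₂ _+_ (zeros+ones≡length w) (inversions+triangle w) ⟩
  length w + positionSum w ∎
  where
  lemma : ∀ z i o t → z + i + (o + t) ≡ (z + o) + (i + t)
  lemma = solve-∀

positionSum-interleave : ∀ p q → length p ≡ length q →
  positionSum (interleave p q) ≡ positionSum p * 2 + positionSum q * 2 + ones p
positionSum-interleave []          []          _ = refl
positionSum-interleave (false ∷ p) (false ∷ q) e = positionSum-interleave p q (suc-injective e)
positionSum-interleave (false ∷ p) (true ∷ q)  e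
  rewrite length-interleave p q | positionSum-interleave p q (suc-injective e) | sym (suc-injective e) =
  lemma (length p) (positionSum p) (positionSum q) (ones p)
  where
  lemma : ∀ L a b o → L + L + (a * 2 + b * 2 + o) ≡ a * 2 + (L + b) * 2 + o
  lemma = solve-∀
positionSum-interleave (true ∷ p)  (false ∷ q) e
  rewrite length-interleave p q | positionSum-interleave p q (suc-injective e) | sym (suc-injective e) =
  lemma (length p) (positionSum p) (positionSum q) (ones p)
  where
  lemma : ∀ L a b o → suc (L + L + (a * 2 + b * 2 + o)) ≡ (L + a) * 2 + b * 2 + suc o
  lemma = solve-∀
positionSum-interleave (true ∷ p)  (true ∷ q)  e
  rewrite length-interleave p q | positionSum-interleave p q (suc-injective e) | sym (suc-injective e) =
  lemma (length p) (positionSum p) (positionSum q) (ones p)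
  where
  lemma : ∀ L a b o → suc (L + L + (L + L + (a * 2 + b * 2 + o))) ≡ (L + a) * 2 + (L + b) * 2 + suc o
  lemma = solve-∀

inversions-interleave : ∀ p q → length p ≡ length q →
  inversions (interleave p q) ≡ inversions p * 2 + inversions q * 2 + triangle (suc (diffCode (ones p) (ones q)))
inversions-interleave p q e = +-cancelʳ-≡ (triangle (ones p + ones q)) _ _ (begin
  inversions (interleave p q) + triangle (ones p + ones q)
    ≡⟨ cong (λ n → inversions (interleave p q) + triangle n) (sym (ones-interleave p q)) ⟩
  inversions (interleave p q) + triangle (ones (interleave p q))
    ≡⟨ inversions+triangle (interleave p q) ⟩
  positionSum (interleave p q)
    ≡⟨ positionSum-interleave p q e ⟩
  positionSum p * 2 + positionSum q * 2 + ones p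
    ≡⟨ cong₂ (λ a b → a * 2 + b * 2 + ones p) (sym (inversions+triangle p)) (sym (inversions+triangle q)) ⟩
  (inversions p + triangle (ones p)) * 2 + (inversions q + triangle (ones q)) * 2 + ones p
    ≡⟨ regroup (inversions p) (inversions q) (triangle (ones p)) (triangle (ones q)) (ones p) ⟩
  inversions p * 2 + inversions q * 2 + (triangle (ones p) * 2 + triangle (ones q) * 2 + ones p)
    ≡⟨ cong (inversions p * 2 + inversions q * 2 +_) (sym (triangle-diffCode (ones p) (ones q))) ⟩
  inversions p * 2 + inversions q * 2 + (triangle (ones p + ones q) + triangle (suc c))
    ≡⟨ swap (inversions p * 2 + inversions q * 2) (triangle (ones p + ones q)) (triangle (suc c)) ⟩
  inversions p * 2 + inversions q * 2 + triangle (suc c) + triangle (ones p + ones q) ∎)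
  where
  c = diffCode (ones p) (ones q)
  regroup : ∀ a b s t o → (a + s) * 2 + (b + t) * 2 + o ≡ a * 2 + b * 2 + (s * 2 + t * 2 + o)
  regroup = solve-∀
  swap : ∀ a s t → a + (s + t) ≡ a + t + s
  swap = solve-∀

sum-part-interleave : ∀ p q → length p ≡ length q →
  sum (part (interleave p q)) ≡ sum (part p) * 2 + sum (part q) * 2 + triangle (suc (diffCode (ones p) (ones q)))
sum-part-interleave p q e = begin
  sum (part (interleave p q))     ≡⟨ sum-part (interleave p q) ⟩
  inversions (interleave p q)     ≡⟨ inversions-interleave p q e ⟩
  inversions p * 2 + inversions q * 2 + triangle (suc (diffCode (ones p) (ones q)))
    ≡⟨ cong₂ (λ a b → a * 2 + b * 2 + triangle (suc (diffCode (ones p) (ones q)))) (sym (sum-part p)) (sym (sum-part q)) ⟩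
  sum (part p) * 2 + sum (part q) * 2 + triangle (suc (diffCode (ones p) (ones q))) ∎

zeros-balanced : ∀ {p q p′ q′} → length p ≡ length q → length p′ ≡ length q′ →
                 ones p + ones q′ ≡ ones p′ + ones q → zeros p′ + zeros q ≡ zeros p + zeros q′
zeros-balanced {p} {q} {p′} {q′} lp lp′ balanced = +-cancelʳ-≡ (ones p + ones q′) _ _ (begin
  zeros p′ + zeros q + (ones p + ones q′)     ≡⟨ cong (zeros p′ + zeros q +_) balanced ⟩
  zeros p′ + zeros q + (ones p′ + ones q)     ≡⟨ regroup (zeros p′) (zeros q) (ones p′) (ones q) ⟩
  (zeros p′ + ones p′) + (zeros q + ones q)   ≡⟨ cong₂ _+_ (zeros+ones≡length p′) (zeros+ones≡length q) ⟩
  length p′ + length q                        ≡⟨ cong₂ _+_ lp′ (sym lp) ⟩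
  length q′ + length p                        ≡⟨ sym (cong₂ _+_ (zeros+ones≡length q′) (zeros+ones≡length p)) ⟩
  (zeros q′ + ones q′) + (zeros p + ones p)   ≡⟨ regroup′ (zeros p) (zeros q′) (ones p) (ones q′) ⟩
  zeros p + zeros q′ + (ones p + ones q′)     ∎)
  where
  regroup : ∀ a b c d → a + b + (c + d) ≡ (a + c) + (b + d)
  regroup = solve-∀
  regroup′ : ∀ a b c d → (b + d) + (a + c) ≡ a + b + (c + d)
  regroup′ = solve-∀

part-interleave-cong : ∀ {p q p′ q′} → length p ≡ length q → length p′ ≡ length q′ →
  part p ≡ part p′ → part q ≡ part q′ → ones p + ones q′ ≡ ones p′ + ones q →
  part (interleave p q) ≡ part (interleave p′ q′)
-- Padding p and q by the letter counts of p′, and p′ and q′ by those of p, makes the pairs equal.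
part-interleave-cong {p} {q} {p′} {q′} lp lp′ same-p same-q balanced = begin
  part (interleave p q)                                ≡⟨ sym (part-pad (i + i) (j + j) _) ⟩
  part (pad (i + i) (j + j) (interleave p q))          ≡⟨ cong part (sym (interleave-pad i j p q lp)) ⟩
  part (interleave (pad i j p) (pad i j q))            ≡⟨ cong₂ (λ u v → part (interleave u v)) p≡ q≡ ⟩
  part (interleave (pad i′ j′ p′) (pad i′ j′ q′))      ≡⟨ cong part (interleave-pad i′ j′ p′ q′ lp′) ⟩
  part (pad (i′ + i′) (j′ + j′) (interleave p′ q′))    ≡⟨ part-pad (i′ + i′) (j′ + j′) _ ⟩
  part (interleave p′ q′)                              ∎
  where
  i j i′ j′ : ℕ
  i = zeros p′
  j = ones p′
  i′ = zeros p
  j′ = ones p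
  p≡ : pad i j p ≡ pad i′ j′ p′
  p≡ = pad-≡ {p} {p′} i j i′ j′ same-p (+-comm (zeros p′) (zeros p)) (+-comm (ones p) (ones p′))
  q≡ : pad i j q ≡ pad i′ j′ q′
  q≡ = pad-≡ {q} {q′} i j i′ j′ same-q (zeros-balanced {p} {q} {p′} {q′} lp lp′ balanced)
         (trans (+-comm (ones q) (ones p′)) (trans (sym balanced) (+-comm (ones p) (ones q′))))

parity-zeros : ∀ {p q} → length p ≡ length q → parity (ones p + ones q) ≡ 0ℙ → parity (zeros p + zeros q) ≡ 0ℙ
parity-zeros {p} {q} lp even = begin
  parity (zeros p + zeros q)                                ≡⟨ sym (ℙ.+-identityʳ _) ⟩
  parity (zeros p + zeros q) +ℙ 0ℙ                          ≡⟨ cong (parity (zeros p + zeros q) +ℙ_) (sym even) ⟩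
  parity (zeros p + zeros q) +ℙ parity (ones p + ones q)    ≡⟨ sym (ℙ.+-homo-+ (zeros p + zeros q) _) ⟩
  parity (zeros p + zeros q + (ones p + ones q))            ≡⟨ cong parity total ⟩
  parity (length p + length p)                              ≡⟨ parity-double (length p) ⟩
  0ℙ                                                        ∎
  where
  total : zeros p + zeros q + (ones p + ones q) ≡ length p + length p
  total = begin
    zeros p + zeros q + (ones p + ones q)    ≡⟨ regroup (zeros p) (zeros q) (ones p) (ones q) ⟩
    (zeros p + ones p) + (zeros q + ones q)  ≡⟨ cong₂ _+_ (zeros+ones≡length p) (trans (zeros+ones≡length q) (sym lp)) ⟩
    length p + length p                      ∎
    where
    regroup : ∀ a b c d → a + b + (c + d) ≡ (a + c) + (b + d)
    regroup = solve-∀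

part-interleave-injective : ∀ {p q p′ q′} → length p ≡ length q → length p′ ≡ length q′ →
  parity (ones p + ones q) ≡ 0ℙ → parity (ones p′ + ones q′) ≡ 0ℙ →
  part (interleave p q) ≡ part (interleave p′ q′) →
  part p ≡ part p′ × part q ≡ part q′ × ones p + ones q′ ≡ ones p′ + ones q
-- Both interleaved words have even letter counts, so they become equal after even paddings,
-- which are interleavings of padded halves.
part-interleave-injective {p} {q} {p′} {q′} lp lp′ even even′ same
  with parity≡0⇒double _ (parity-zeros {p} {q} lp even) | parity≡0⇒double _ (parity-zeros {p′} {q′} lp′ even′)
     | parity≡0⇒double _ even | parity≡0⇒double _ even′
... | z , zeros≡ | z′ , zeros′≡ | o , ones≡ | o′ , ones′≡ =
  same-part p≡ , same-part q≡ , difference-≡ o′ o (same-ones p≡) (same-ones q≡)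
  where
  w w′ : Word
  w = interleave p q
  w′ = interleave p′ q′
  padded : pad (z′ + z′) (o′ + o′) w ≡ pad (z + z) (o + o) w′
  padded = pad-≡ {w} {w′} _ _ _ _ same
    (trans (cong ((z′ + z′) +_) (trans (zeros-interleave p q) zeros≡))
      (trans (+-comm (z′ + z′) (z + z)) (cong ((z + z) +_) (sym (trans (zeros-interleave p′ q′) zeros′≡)))))
    (trans (cong (_+ (o′ + o′)) (trans (ones-interleave p q) ones≡))
      (trans (+-comm (o + o) (o′ + o′)) (cong (_+ (o + o)) (sym (trans (ones-interleave p′ q′) ones′≡)))))
  halves : pad z′ o′ p ≡ pad z o p′ × pad z′ o′ q ≡ pad z o q′
  halves = interleave-injective (length-pad-cong z′ o′ lp) (length-pad-cong z o lp′)
             (trans (interleave-pad z′ o′ p q lp) (trans padded (sym (interleave-pad z o p′ q′ lp′))))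
  p≡ : pad z′ o′ p ≡ pad z o p′
  p≡ = proj₁ halves
  q≡ : pad z′ o′ q ≡ pad z o q′
  q≡ = proj₂ halves
  same-part : ∀ {u u′} → pad z′ o′ u ≡ pad z o u′ → part u ≡ part u′
  same-part {u} {u′} e = trans (sym (part-pad z′ o′ u)) (trans (cong part e) (part-pad z o u′))
  same-ones : ∀ {u u′} → pad z′ o′ u ≡ pad z o u′ → ones u + o′ ≡ ones u′ + o
  same-ones {u} {u′} e = trans (sym (ones-pad z′ o′ u)) (trans (cong ones e) (ones-pad z o u′))

-- Padded so that both letter counts are even, which makes the split data independent of the padding.
evenBoundary : List ℕ → Word
evenBoundary μ = pad (largestPart μ) (length μ) (boundary μ)

part-evenBoundary : ∀ μ → IsPartition μ → part (evenBoundary μ) ≡ μ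
part-evenBoundary μ μ-part = trans (part-pad (largestPart μ) (length μ) (boundary μ)) (part-boundary μ μ-part)

length-evenBoundary : ∀ μ → Linked _≥_ μ → length (evenBoundary μ) ≡ (largestPart μ + length μ) + (largestPart μ + length μ)
length-evenBoundary μ linked = begin
  length (evenBoundary μ)                              ≡⟨ length-pad (largestPart μ) (length μ) (boundary μ) ⟩
  largestPart μ + (length (boundary μ) + length μ)     ≡⟨ cong (λ n → largestPart μ + (n + length μ)) length-boundary ⟩
  largestPart μ + ((largestPart μ + length μ) + length μ) ≡⟨ lemma (largestPart μ) (length μ) ⟩
  (largestPart μ + length μ) + (largestPart μ + length μ) ∎
  where
  length-boundary : length (boundary μ) ≡ largestPart μ + length μ
  length-boundary = trans (sym (zeros+ones≡length (boundary μ))) (cong₂ _+_ (zeros-boundary μ linked) (ones-boundary μ))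
  lemma : ∀ h ℓ → h + ((h + ℓ) + ℓ) ≡ (h + ℓ) + (h + ℓ)
  lemma = solve-∀

ones-evenBoundary : ∀ μ → ones (evenBoundary μ) ≡ length μ + length μ
ones-evenBoundary μ = trans (ones-pad (largestPart μ) (length μ) (boundary μ)) (cong (_+ length μ) (ones-boundary μ))

module SplitBoundary (μ : List ℕ) where
  p q : Word
  p = proj₁ (split (evenBoundary μ))
  q = proj₂ (split (evenBoundary μ))

  length-p≡q : Linked _≥_ μ → length p ≡ length q
  length-p≡q linked = length-split (largestPart μ + length μ) (evenBoundary μ) (length-evenBoundary μ linked)

  part-interleave : IsPartition μ → part (interleave p q) ≡ μ
  part-interleave μ-part = trans (cong part (interleave-split (evenBoundary μ))) (part-evenBoundary μ μ-part)

  parity-ones : parity (ones p + ones q) ≡ 0ℙ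
  parity-ones = begin
    parity (ones p + ones q)              ≡⟨ cong parity (sym (ones-interleave p q)) ⟩
    parity (ones (interleave p q))        ≡⟨ cong (parity ∘ ones) (interleave-split (evenBoundary μ)) ⟩
    parity (ones (evenBoundary μ))        ≡⟨ cong parity (ones-evenBoundary μ) ⟩
    parity (length μ + length μ)          ≡⟨ parity-double (length μ) ⟩
    0ℙ                                    ∎

QuotientData : Set
QuotientData = List ℕ × List ℕ × ℕ

pairData : Word × Word → QuotientData
pairData (p , q) = part p , part q , diffCode (ones p) (ones q)

-- The 2-quotient (q₀ , q₁) of μ and the number m of parts of its 2-core, the staircase of size triangle (suc m).
quotient : List ℕ → QuotientData
quotient μ = pairData (split (evenBoundary μ))

weight : QuotientData → ℕ
weight (q₀ , q₁ , m) = sum q₀ * 2 + sum q₁ * 2 + triangle (suc m)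

-- Boundaries of q₀ and q₁, padded to equal length and to numbers of 1s whose difference has code m.
module QuotientWords (q₀ q₁ : List ℕ) (m : ℕ) where
  x₀ y₀ e₀ e₁ n₀ n₁ : ℕ
  x₀ = proj₁ (codeOffsets m)
  y₀ = proj₂ (codeOffsets m)
  e₀ = length q₁ + x₀
  e₁ = length q₀ + y₀
  n₀ = length (boundary q₀) + e₀
  n₁ = length (boundary q₁) + e₁

  P Q : Word
  P = pad n₁ e₀ (boundary q₀)
  Q = pad n₀ e₁ (boundary q₁)

  length-P≡Q : length P ≡ length Q
  length-P≡Q = trans (length-pad n₁ e₀ (boundary q₀)) (trans (+-comm n₁ n₀) (sym (length-pad n₀ e₁ (boundary q₁))))

  ones-P : ones P ≡ length q₀ + e₀
  ones-P = trans (ones-pad n₁ e₀ (boundary q₀)) (cong (_+ e₀) (ones-boundary q₀))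

  ones-Q : ones Q ≡ length q₁ + e₁
  ones-Q = trans (ones-pad n₀ e₁ (boundary q₁)) (cong (_+ e₁) (ones-boundary q₁))

  parity-ones : parity (ones P + ones Q) ≡ 0ℙ
  parity-ones = begin
    parity (ones P + ones Q)                                   ≡⟨ cong parity (cong₂ _+_ ones-P ones-Q) ⟩
    parity (length q₀ + e₀ + (length q₁ + e₁))                 ≡⟨ cong parity (regroup (length q₀) (length q₁) x₀ y₀) ⟩
    parity ((length q₀ + length q₁) + ((length q₀ + length q₁) + (x₀ + y₀))) ≡⟨ parity-double-+ (length q₀ + length q₁) (x₀ + y₀) ⟩
    parity (x₀ + y₀)                                           ≡⟨ parity-codeOffsets m ⟩
    0ℙ                                                         ∎
    where
    regroup : ∀ a b x y → a + (b + x) + (b + (a + y)) ≡ (a + b) + ((a + b) + (x + y))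
    regroup = solve-∀

  diffCode-ones : diffCode (ones P) (ones Q) ≡ m
  diffCode-ones = begin
    diffCode (ones P) (ones Q)                  ≡⟨ cong₂ diffCode ones-P ones-Q ⟩
    diffCode (length q₀ + e₀) (length q₁ + e₁)  ≡⟨ diffCode-cong {length q₀ + e₀} {length q₁ + e₁} {x₀} {y₀} (shift (length q₀) (length q₁) x₀ y₀) ⟩
    diffCode x₀ y₀                              ≡⟨ diffCode-codeOffsets m ⟩
    m                                           ∎
    where
    shift : ∀ a b x y → a + (b + x) + y ≡ x + (b + (a + y))
    shift = solve-∀

  pairData-PQ : IsPartition q₀ → IsPartition q₁ → pairData (P , Q) ≡ (q₀ , q₁ , m)
  pairData-PQ q₀-part q₁-part =
    cong₂ _,_ (trans (part-pad n₁ e₀ (boundary q₀)) (part-boundary q₀ q₀-part))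
              (cong₂ _,_ (trans (part-pad n₀ e₁ (boundary q₁)) (part-boundary q₁ q₁-part)) diffCode-ones)

fromQuotient : QuotientData → List ℕ
fromQuotient (q₀ , q₁ , m) = part (interleave P Q)
  where open QuotientWords q₀ q₁ m

fromQuotient-quotient : ∀ μ → IsPartition μ → fromQuotient (quotient μ) ≡ μ
fromQuotient-quotient μ μ-part = begin
  part (interleave P Q) ≡⟨ part-interleave-cong {P} {Q} {p} {q} length-P≡Q (length-p≡q (proj₂ μ-part)) part-P part-Q balanced ⟩
  part (interleave p q) ≡⟨ part-interleave μ-part ⟩
  μ                     ∎
  where
  open SplitBoundary μ
  open QuotientWords (part p) (part q) (diffCode (ones p) (ones q))
    renaming (parity-ones to parity-ones-PQ)
  part-P : part P ≡ part p
  part-P = cong proj₁ (pairData-PQ (part-isPartition p) (part-isPartition q))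
  part-Q : part Q ≡ part q
  part-Q = cong (proj₁ ∘ proj₂) (pairData-PQ (part-isPartition p) (part-isPartition q))
  balanced : ones P + ones q ≡ ones p + ones Q
  balanced = diffCode-injective {ones P} {ones Q} {ones p} {ones q} parity-ones-PQ parity-ones diffCode-ones

quotient-fromQuotient : ∀ q₀ q₁ m → IsPartition q₀ → IsPartition q₁ → quotient (fromQuotient (q₀ , q₁ , m)) ≡ (q₀ , q₁ , m)
quotient-fromQuotient q₀ q₁ m q₀-part q₁-part = begin
  pairData (p , q) ≡⟨ cong₂ _,_ part-p≡P (cong₂ _,_ part-q≡Q (diffCode-cong {ones p} {ones q} {ones P} {ones Q} balanced)) ⟩
  pairData (P , Q) ≡⟨ pairData-PQ q₀-part q₁-part ⟩
  (q₀ , q₁ , m)    ∎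
  where
  open QuotientWords q₀ q₁ m
  open SplitBoundary (part (interleave P Q)) renaming (parity-ones to parity-ones-pq)
  μ-part : IsPartition (part (interleave P Q))
  μ-part = part-isPartition (interleave P Q)
  similar : part p ≡ part P × part q ≡ part Q × ones p + ones Q ≡ ones P + ones q
  similar = part-interleave-injective {p} {q} {P} {Q} (length-p≡q (proj₂ μ-part)) length-P≡Q parity-ones-pq parity-ones (part-interleave μ-part)
  part-p≡P : part p ≡ part P
  part-p≡P = proj₁ similar
  part-q≡Q : part q ≡ part Q
  part-q≡Q = proj₁ (proj₂ similar)
  balanced : ones p + ones Q ≡ ones P + ones q
  balanced = proj₂ (proj₂ similar)

sum-quotient : ∀ μ → IsPartition μ → sum μ ≡ weight (quotient μ)
sum-quotient μ μ-part = begin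
  sum μ                      ≡⟨ cong sum (sym (part-interleave μ-part)) ⟩
  sum (part (interleave p q)) ≡⟨ sum-part-interleave p q (length-p≡q (proj₂ μ-part)) ⟩
  weight (quotient μ)        ∎
  where open SplitBoundary μ

quotient-isPartition : ∀ μ → IsPartition (proj₁ (quotient μ)) × IsPartition (proj₁ (proj₂ (quotient μ)))
quotient-isPartition μ = part-isPartition p , part-isPartition q
  where open SplitBoundary μ

fromQuotient-isPartition : ∀ d → IsPartition (fromQuotient d)
fromQuotient-isPartition (q₀ , q₁ , m) = part-isPartition (interleave P Q)
  where open QuotientWords q₀ q₁ m

double : List ℕ → List ℕ
double = map (_* 2)

halve : List ℕ → List ℕ
halve = map ⌊_/2⌋

⌊n*2/2⌋≡n : ∀ n → ⌊ n * 2 /2⌋ ≡ n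
⌊n*2/2⌋≡n zero    = refl
⌊n*2/2⌋≡n (suc n) = cong suc (⌊n*2/2⌋≡n n)

halve-double : ∀ μ → halve (double μ) ≡ μ
halve-double []      = refl
halve-double (k ∷ μ) = cong₂ _∷_ (⌊n*2/2⌋≡n k) (halve-double μ)

double-halve : ∀ μ → All (2 ∣_) μ → double (halve μ) ≡ μ
double-halve []      []                     = refl
double-halve (_ ∷ μ) (divides k refl ∷ even) = cong₂ _∷_ (cong (_* 2) (⌊n*2/2⌋≡n k)) (double-halve μ even)

double-allEven : ∀ μ → All (2 ∣_) (double μ)
double-allEven []      = []
double-allEven (k ∷ μ) = divides k refl ∷ double-allEven μ

sum-double : ∀ μ → sum (double μ) ≡ sum μ * 2
sum-double []      = refl
sum-double (k ∷ μ) = trans (cong (k * 2 +_) (sum-double μ)) (sym (*-distribʳ-+ 2 k (sum μ)))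

map-linked : ∀ (f : ℕ → ℕ) → (∀ {a b} → a ≤ b → f a ≤ f b) → ∀ {μ} → Linked _≥_ μ → Linked _≥_ (map f μ)
map-linked f mono []         = []
map-linked f mono [-]        = [-]
map-linked f mono (k≥l ∷ ls) = mono k≥l ∷ map-linked f mono ls

double-isPartition : ∀ {μ} → IsPartition μ → IsPartition (double μ)
double-isPartition (positive , linked) = positive′ positive , map-linked (_* 2) (*-monoˡ-≤ 2) linked
  where
  positive′ : ∀ {μ} → All (0 <_) μ → All (0 <_) (double μ)
  positive′ []              = []
  positive′ (s≤s z≤n ∷ ps) = s≤s z≤n ∷ positive′ ps

halve-isPartition : ∀ {μ} → IsPartition μ → All (2 ∣_) μ → IsPartition (halve μ)
halve-isPartition (positive , linked) even = positive′ positive even , map-linked ⌊_/2⌋ ⌊n/2⌋-mono linked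
  where
  positive′ : ∀ {μ} → All (0 <_) μ → All (2 ∣_) μ → All (0 <_) (halve μ)
  positive′ []       []                          = []
  positive′ (_ ∷ ps) (divides (suc k) refl ∷ es) = s≤s z≤n ∷ positive′ ps es
  positive′ (() ∷ _) (divides zero refl ∷ _)

staircase-isPartition : ∀ m → IsPartition (staircase m)
staircase-isPartition zero          = [] , []
staircase-isPartition (suc zero)    = s≤s z≤n ∷ [] , [-]
staircase-isPartition (suc (suc m)) with staircase-isPartition (suc m)
... | positive , linked = s≤s z≤n ∷ positive , n≤1+n (suc m) ∷ linked

sum-staircase : ∀ m → sum (staircase m) ≡ triangle (suc m)
sum-staircase zero    = refl
sum-staircase (suc m) = cong (suc m +_) (sum-staircase m)

length-staircase : ∀ m → length (staircase m) ≡ m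
length-staircase zero    = refl
length-staircase (suc m) = cong suc (length-staircase m)

staircase-length-inverse : ∀ {μ} → (∃ λ m → μ ≡ staircase m) → staircase (length μ) ≡ μ
staircase-length-inverse (m , refl) = cong staircase (length-staircase m)

-- The validity fields of Partition, A and V24 are irrelevant; the round trips recover them with recompute.
isPartition? : ∀ μ → Dec (IsPartition μ)
isPartition? μ = all? (0 <?_) μ ×-dec linked? _≥?_ μ

allEven? : ∀ μ → Dec (All (2 ∣_) μ)
allEven? μ = all? (2 ∣?_) μ

partition-≡ : ∀ {μ ν} .{μ-part ν-part} → μ ≡ ν → mkPartition μ μ-part ≡ mkPartition ν ν-part
partition-≡ refl = refl

sum-components : ∀ q₀ q₁ m s → sum (double q₀) + sum (double q₁) + s + sum (staircase m) ≡ weight (q₀ , q₁ , m) + s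
sum-components q₀ q₁ m s = begin
  sum (double q₀) + sum (double q₁) + s + sum (staircase m)
    ≡⟨ cong₂ _+_ (cong₂ (λ a b → a + b + s) (sum-double q₀) (sum-double q₁)) (sum-staircase m) ⟩
  sum q₀ * 2 + sum q₁ * 2 + s + triangle (suc m)
    ≡⟨ swap (sum q₀ * 2 + sum q₁ * 2) s (triangle (suc m)) ⟩
  sum q₀ * 2 + sum q₁ * 2 + triangle (suc m) + s ∎
  where
  swap : ∀ a s t → a + s + t ≡ a + t + s
  swap = solve-∀

toV24 : ∀ {n} → A n → V24 n
toV24 (mkA (mkPartition μ μ-part) b b-even size≡) =
  mkV (mkPartition (double q₀) (double-isPartition (proj₁ (quotient-isPartition μ))))
      (mkPartition (double q₁) (double-isPartition (proj₂ (quotient-isPartition μ))))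
      b
      (mkPartition (staircase m) (staircase-isPartition m))
      (double-allEven q₀) (double-allEven q₁) b-even (m , refl)
      (trans (sum-components q₀ q₁ m (size b)) (trans (cong (_+ size b) (sym (sum-quotient μ μ-part))) size≡))
  where
  q₀ q₁ : List ℕ
  q₀ = proj₁ (quotient μ)
  q₁ = proj₁ (proj₂ (quotient μ))
  m : ℕ
  m = proj₂ (proj₂ (quotient μ))

fromV24-size : ∀ {μ₁ μ₂ μ₄ s n} → IsPartition μ₁ → IsPartition μ₂ → All (2 ∣_) μ₁ → All (2 ∣_) μ₂ →
             staircase (length μ₄) ≡ μ₄ → sum μ₁ + sum μ₂ + s + sum μ₄ ≡ n →
             sum (fromQuotient (halve μ₁ , halve μ₂ , length μ₄)) + s ≡ n
fromV24-size {μ₁} {μ₂} {μ₄} {s} {n} μ₁-part μ₂-part even₁ even₂ stair size≡ = begin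
  sum (fromQuotient d) + s             ≡⟨ cong (_+ s) (sum-quotient (fromQuotient d) (fromQuotient-isPartition d)) ⟩
  weight (quotient (fromQuotient d)) + s
    ≡⟨ cong (λ e → weight e + s) (quotient-fromQuotient (halve μ₁) (halve μ₂) (length μ₄) (halve-isPartition μ₁-part even₁) (halve-isPartition μ₂-part even₂)) ⟩
  weight d + s                         ≡⟨ sym (sum-components (halve μ₁) (halve μ₂) (length μ₄) s) ⟩
  sum (double (halve μ₁)) + sum (double (halve μ₂)) + s + sum (staircase (length μ₄))
    ≡⟨ cong₂ (λ a b → sum a + sum b + s + sum (staircase (length μ₄))) (double-halve μ₁ even₁) (double-halve μ₂ even₂) ⟩
  sum μ₁ + sum μ₂ + s + sum (staircase (length μ₄)) ≡⟨ cong (λ ν → sum μ₁ + sum μ₂ + s + sum ν) stair ⟩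
  sum μ₁ + sum μ₂ + s + sum μ₄         ≡⟨ size≡ ⟩
  n                                    ∎
  where
  d : QuotientData
  d = halve μ₁ , halve μ₂ , length μ₄

fromV24 : ∀ {n} → V24 n → A n
fromV24 (mkV (mkPartition μ₁ μ₁-part) (mkPartition μ₂ μ₂-part) λ₃ (mkPartition μ₄ _) even₁ even₂ even₃ stair₄ size≡) =
  mkA (mkPartition (fromQuotient d) (fromQuotient-isPartition d)) λ₃ even₃
      (fromV24-size μ₁-part μ₂-part even₁ even₂ (staircase-length-inverse stair₄) size≡)
  where
  d : QuotientData
  d = halve μ₁ , halve μ₂ , length μ₄

A-≡ : ∀ {n ρ ρ′ β} .{e s e′ s′} → ρ ≡ ρ′ → mkA {n} ρ β e s ≡ mkA ρ′ β e′ s′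
A-≡ refl = refl

V-≡ : ∀ {n λ₁ λ₁′ λ₂ λ₂′ λ₃ λ₄ λ₄′} .{a₁ a₂ a₃ a₄ a₅ b₁ b₂ b₃ b₄ b₅} → λ₁ ≡ λ₁′ → λ₂ ≡ λ₂′ → λ₄ ≡ λ₄′ →
      mkV {n} λ₁ λ₂ λ₃ λ₄ a₁ a₂ a₃ a₄ a₅ ≡ mkV λ₁′ λ₂′ λ₃ λ₄′ b₁ b₂ b₃ b₄ b₅
V-≡ refl refl refl = refl

fromV24-toV24 : ∀ {n} (a : A n) → fromV24 (toV24 a) ≡ a
fromV24-toV24 (mkA (mkPartition μ μ-part) _ _ _) = A-≡ (partition-≡ (begin
  fromQuotient (halve (double q₀) , halve (double q₁) , length (staircase m))
    ≡⟨ cong₂ (λ a b → fromQuotient (a , b , length (staircase m))) (halve-double q₀) (halve-double q₁) ⟩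
  fromQuotient (q₀ , q₁ , length (staircase m)) ≡⟨ cong (λ k → fromQuotient (q₀ , q₁ , k)) (length-staircase m) ⟩
  fromQuotient (quotient μ)                     ≡⟨ fromQuotient-quotient μ (recompute (isPartition? μ) μ-part) ⟩
  μ                                             ∎))
  where
  q₀ q₁ : List ℕ
  q₀ = proj₁ (quotient μ)
  q₁ = proj₁ (proj₂ (quotient μ))
  m : ℕ
  m = proj₂ (proj₂ (quotient μ))

toV24-fromV24 : ∀ {n} (v : V24 n) → toV24 (fromV24 v) ≡ v
toV24-fromV24 (mkV (mkPartition μ₁ μ₁-part) (mkPartition μ₂ μ₂-part) _ (mkPartition μ₄ _) even₁ even₂ _ stair₄ _) =
  V-≡ (partition-≡ (trans (cong (double ∘ proj₁) round-trip) (double-halve μ₁ (recompute (allEven? μ₁) even₁))))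
      (partition-≡ (trans (cong (double ∘ proj₁ ∘ proj₂) round-trip) (double-halve μ₂ (recompute (allEven? μ₂) even₂))))
      (partition-≡ (trans (cong (staircase ∘ proj₂ ∘ proj₂) round-trip)
                          (recompute (≡-dec _≟_ (staircase (length μ₄)) μ₄) (staircase-length-inverse stair₄))))
  where
  round-trip : quotient (fromQuotient (halve μ₁ , halve μ₂ , length μ₄)) ≡ (halve μ₁ , halve μ₂ , length μ₄)
  round-trip = quotient-fromQuotient (halve μ₁) (halve μ₂) (length μ₄)
    (halve-isPartition (recompute (isPartition? μ₁) μ₁-part) (recompute (allEven? μ₁) even₁))
    (halve-isPartition (recompute (isPartition? μ₂) μ₂-part) (recompute (allEven? μ₂) even₂))

lemma4p1 : (n : ℕ) → A n ⤖ V24 n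
lemma4p1 n = ↔⇒⤖ (mk↔ₛ′ toV24 fromV24 toV24-fromV24 fromV24-toV24)
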